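{- Let \((G,c_G)\) and \((H,c_H)\) be complete-convex \(2\)-edge-coloured graphs. Then any \(2\)-edge-coloured graph formed by identifying a red edge of \((G,c_G)\) with a red edge of \((H,c_H)\), or a blue edge of \((G,c_G)\) with a blue edge of \((H,c_H)\), is complete convex.
   Context: A \(2\)-edge-coloured graph is a pair \((G,c_G)\), \(G\) a graph without parallel edges, \(c_G:E_G\to\{R,B\}\) (red, blue). A path \(u,v,w\) with \(uv,vw\in E_G\), \(u\ne v\ne w\), is an alternating \(2\)-path with centre \(v\) if \(c_G(uv)\ne c_G(vw)\). A vertex set \(S\) is convex if no vertex outside \(S\) is the centre of an alternating \(2\)-path with both ends in \(S\); \(conv(S)\) is the smallest convex superset of \(S\). \((G,c_G)\) is complete convex if \(conv(\{u,v\})=V_G\) for every edge \(uv\). -}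

module Defs where

open import Data.Nat using (ℕ)
open import Data.Fin using (Fin)
open import Data.Fin.Subset using (Subset; _∈_; _⊆_; _∪_; ⁅_⁆)
open import Data.Maybe using (Maybe; just; nothing)
open import Data.Product using (Σ; ∃; _×_; _,_)
open import Data.Sum using (_⊎_)
open import Relation.Binary.PropositionalEquality using (_≡_; _≢_)

data Colour : Set where
  red blue : Colour

-- A finite 2-edge-coloured graph without parallel edges (and without loops):
-- vertices are Fin size; col x y = nothing means "no edge", just c means an
-- edge of colour c. Symmetric and loopless.
record Graph : Set where
  field
    size     : ℕ
    col      : Fin size → Fin size → Maybe Colour
    sym      : ∀ x y → col x y ≡ col y x
    loopless : ∀ x → col x x ≡ nothing
open Graph public

Vertex : Graph → Set
Vertex G = Fin (size G)

Edge : (G : Graph) → Vertex G → Vertex G → Set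
Edge G u v = ∃ λ c → col G u v ≡ just c

AltPath : (G : Graph) → Vertex G → Vertex G → Vertex G → Set
AltPath G u v w =
  u ≢ v × v ≢ w × u ≢ w ×
  Σ Colour λ c₁ → Σ Colour λ c₂ →
    col G u v ≡ just c₁ × col G v w ≡ just c₂ × c₁ ≢ c₂

Convex : (G : Graph) → Subset (size G) → Set
Convex G S = ∀ u v w → AltPath G u v w → u ∈ S → w ∈ S → v ∈ S

-- x ∈ conv(S): x lies in every convex superset of S
-- (conv(S) is the smallest convex superset = intersection of all of them).
InConv : (G : Graph) → Subset (size G) → Vertex G → Set
InConv G S x = ∀ (T : Subset (size G)) → S ⊆ T → Convex G T → x ∈ T

CompleteConvex : Graph → Set
CompleteConvex G =
  ∀ u v → Edge G u v → ∀ x → InConv G (⁅ u ⁆ ∪ ⁅ v ⁆) x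

-- K is (up to isomorphism) the graph obtained from disjoint copies of G and H
-- by identifying vertex a with c and b with d (so the edge ab of G is
-- identified with the edge cd of H). f and g are the embeddings of G and H.
record Identification (G H K : Graph)
                      (a b : Vertex G) (c d : Vertex H) : Set where
  field
    f       : Vertex G → Vertex K
    g       : Vertex H → Vertex K
    f-inj   : ∀ x x' → f x ≡ f x' → x ≡ x'
    g-inj   : ∀ y y' → g y ≡ g y' → y ≡ y'
    cover   : ∀ z → (∃ λ x → f x ≡ z) ⊎ (∃ λ y → g y ≡ z)
    glue-a  : f a ≡ g c
    glue-b  : f b ≡ g d
    shared  : ∀ x y → f x ≡ g y → (x ≡ a × y ≡ c) ⊎ (x ≡ b × y ≡ d)
    col-f   : ∀ x x' → col K (f x) (f x') ≡ col G x x'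
    col-g   : ∀ y y' → col K (g y) (g y') ≡ col H y y'
    cross   : ∀ x y → (∀ y' → f x ≢ g y') → (∀ x' → g y ≢ f x') →
              col K (f x) (g y) ≡ nothing

module Submission where

open import Defs
open import Data.Maybe using (just)
open import Data.Nat using (ℕ)
open import Data.Fin using (Fin; _≟_)
open import Data.Fin.Properties using (any?)
open import Data.Fin.Subset using (Subset; _∈_; _⊆_; _∪_; ⁅_⁆)
open import Data.Fin.Subset.Properties using (x∈⁅x⁆; x∈⁅y⁆⇒x≡y; x∈p∪q⁻; x∈p∪q⁺)
open import Data.Vec using (tabulate; lookup)
open import Data.Vec.Properties using ([]=⇒lookup; lookup⇒[]=; lookup∘tabulate)
open import Data.Product using (∃₂; _×_; _,_)
open import Data.Sum using (_⊎_; inj₁; inj₂)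
open import Relation.Nullary using (yes; no)
open import Relation.Binary.PropositionalEquality
  using (_≡_; refl; trans; subst) renaming (sym to ≡-sym)

-- Gluing G and H along the edges ab and cd: a convex set of the glued graph
-- pulls back to convex sets of G and H.  If it contains both ends of an edge
-- of (the image of) G, complete convexity of G puts all of G into it, in
-- particular the glued edge; complete convexity of H then puts all of H into
-- it, and G and H cover the glued graph.  Every edge of the glued graph lies
-- inside G or inside H, since there are no cross edges.

preimage : {n m : ℕ} → (Fin n → Fin m) → Subset m → Subset n
preimage h T = tabulate (λ i → lookup T (h i))

module _ {n m : ℕ} (h : Fin n → Fin m) (T : Subset m) where

  ∈-preimage⁺ : ∀ {i} → h i ∈ T → i ∈ preimage h T
  ∈-preimage⁺ {i} p =
    lookup⇒[]= i (preimage h T) (trans (lookup∘tabulate _ i) ([]=⇒lookup p))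

  ∈-preimage⁻ : ∀ {i} → i ∈ preimage h T → h i ∈ T
  ∈-preimage⁻ {i} p =
    lookup⇒[]= (h i) T (trans (≡-sym (lookup∘tabulate _ i)) ([]=⇒lookup p))

pair⊆ : ∀ {n} {u v : Fin n} {S : Subset n} → u ∈ S → v ∈ S → ⁅ u ⁆ ∪ ⁅ v ⁆ ⊆ S
pair⊆ {u = u} {v} u∈S v∈S p with x∈p∪q⁻ ⁅ u ⁆ ⁅ v ⁆ p
... | inj₁ q rewrite x∈⁅y⁆⇒x≡y u q = u∈S
... | inj₂ q rewrite x∈⁅y⁆⇒x≡y v q = v∈S

module ColourEmbedding (G K : Graph) (h : Vertex G → Vertex K)
  (h-inj : ∀ x x' → h x ≡ h x' → x ≡ x')
  (col-h : ∀ x x' → col K (h x) (h x') ≡ col G x x') where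

  AltPath-map : ∀ {x y w} → AltPath G x y w → AltPath K (h x) (h y) (h w)
  AltPath-map {x} {y} {w} (x≢y , y≢w , x≢w , c₁ , c₂ , e₁ , e₂ , c₁≢c₂) =
    (λ e → x≢y (h-inj x y e)) , (λ e → y≢w (h-inj y w e)) , (λ e → x≢w (h-inj x w e)) ,
    c₁ , c₂ , trans (col-h x y) e₁ , trans (col-h y w) e₂ , c₁≢c₂

  Convex-preimage : ∀ {T} → Convex K T → Convex G (preimage h T)
  Convex-preimage {T} T-convex x y w path x∈ w∈ =
    ∈-preimage⁺ h T (T-convex _ _ _ (AltPath-map path)
      (∈-preimage⁻ h T x∈) (∈-preimage⁻ h T w∈))

  image⊆-convex : CompleteConvex G → ∀ {T} → Convex K T →
                  ∀ {u v} → Edge G u v → h u ∈ T → h v ∈ T → ∀ z → h z ∈ T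
  image⊆-convex G-cc {T} T-convex {u} {v} uv hu∈T hv∈T z =
    ∈-preimage⁻ h T (G-cc u v uv z (preimage h T)
      (pair⊆ (∈-preimage⁺ h T hu∈T) (∈-preimage⁺ h T hv∈T))
      (Convex-preimage T-convex))

EdgeInImage : (G K : Graph) → (Vertex G → Vertex K) →
              Vertex K → Vertex K → Set
EdgeInImage G K h p q = ∃₂ λ x x' → h x ≡ p × h x' ≡ q × Edge G x x'

EdgeInImage-sym : ∀ G K {h : Vertex G → Vertex K} {p q} →
                  EdgeInImage G K h p q → EdgeInImage G K h q p
EdgeInImage-sym G K (x , x' , hx≡p , hx'≡q , k , xx') =
  x' , x , hx'≡q , hx≡p , k , trans (Graph.sym G x' x) xx'

module IdentificationProperties {G H K : Graph} {a b : Vertex G} {c d : Vertex H}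
  (I : Identification G H K a b c d) where
  open Identification I

  EdgeInSide : Vertex K → Vertex K → Set
  EdgeInSide p q = EdgeInImage G K f p q ⊎ EdgeInImage H K g p q

  -- Unless one end lies in both images, cross rules the edge out.
  cross-edge-in-side : ∀ x y → Edge K (f x) (g y) → EdgeInSide (f x) (g y)
  cross-edge-in-side x y (k , xy) with any? (λ x' → g y ≟ f x')
  ... | yes (x' , gy≡fx') =
    inj₁ (x , x' , refl , ≡-sym gy≡fx' , k ,
          trans (≡-sym (col-f x x')) (subst (λ t → col K (f x) t ≡ just k) gy≡fx' xy))
  ... | no gy∉f with any? (λ y' → f x ≟ g y')
  ... | yes (y' , fx≡gy') =
    inj₂ (y' , y , ≡-sym fx≡gy' , refl , k ,
          trans (≡-sym (col-g y' y)) (subst (λ t → col K t (g y) ≡ just k) fx≡gy' xy))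
  ... | no fx∉g
    with trans (≡-sym xy) (cross x y (λ y' e → fx∉g (y' , e)) (λ x' e → gy∉f (x' , e)))
  ... | ()

  edge-in-side : ∀ {p q} → Edge K p q → EdgeInSide p q
  edge-in-side {p} {q} (k , pq) with cover p | cover q
  ... | inj₁ (x , refl) | inj₁ (x' , refl) =
    inj₁ (x , x' , refl , refl , k , trans (≡-sym (col-f x x')) pq)
  ... | inj₂ (y , refl) | inj₂ (y' , refl) =
    inj₂ (y , y' , refl , refl , k , trans (≡-sym (col-g y y')) pq)
  ... | inj₁ (x , refl) | inj₂ (y , refl) = cross-edge-in-side x y (k , pq)
  ... | inj₂ (y , refl) | inj₁ (x , refl)
    with cross-edge-in-side x y (k , trans (Graph.sym K (f x) (g y)) pq)
  ...   | inj₁ e = inj₁ (EdgeInImage-sym G K e)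
  ...   | inj₂ e = inj₂ (EdgeInImage-sym H K e)

  module _ (G-cc : CompleteConvex G) (H-cc : CompleteConvex H)
           (ab : Edge G a b) (cd : Edge H c d)
           {T : Subset (size K)} (T-convex : Convex K T) where
    open ColourEmbedding G K f f-inj col-f using () renaming (image⊆-convex to G-image⊆-convex)
    open ColourEmbedding H K g g-inj col-g using () renaming (image⊆-convex to H-image⊆-convex)

    G-image⊆⇒all∈ : (∀ x → f x ∈ T) → ∀ z → z ∈ T
    G-image⊆⇒all∈ G⊆T z with cover z
    ... | inj₁ (x , refl) = G⊆T x
    ... | inj₂ (y , refl) = H-image⊆-convex H-cc T-convex cd
      (subst (_∈ T) glue-a (G⊆T a)) (subst (_∈ T) glue-b (G⊆T b)) y

    H-image⊆⇒all∈ : (∀ y → g y ∈ T) → ∀ z → z ∈ T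
    H-image⊆⇒all∈ H⊆T z with cover z
    ... | inj₂ (y , refl) = H⊆T y
    ... | inj₁ (x , refl) = G-image⊆-convex G-cc T-convex ab
      (subst (_∈ T) (≡-sym glue-a) (H⊆T c)) (subst (_∈ T) (≡-sym glue-b) (H⊆T d)) x

    edge∈⇒all∈ : ∀ {p q} → EdgeInSide p q → p ∈ T → q ∈ T → ∀ z → z ∈ T
    edge∈⇒all∈ (inj₁ (x , x' , refl , refl , xx')) p∈T q∈T =
      G-image⊆⇒all∈ (G-image⊆-convex G-cc T-convex xx' p∈T q∈T)
    edge∈⇒all∈ (inj₂ (y , y' , refl , refl , yy')) p∈T q∈T =
      H-image⊆⇒all∈ (H-image⊆-convex H-cc T-convex yy' p∈T q∈T)

lemma5 : (G H : Graph) → CompleteConvex G → CompleteConvex H →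
    (κ : Colour) (a b : Vertex G) (c d : Vertex H) →
    col G a b ≡ just κ → col H c d ≡ just κ →
    (K : Graph) → Identification G H K a b c d → CompleteConvex K
lemma5 G H G-cc H-cc κ a b c d ab cd K I u v uv z T uv⊆T T-convex =
  edge∈⇒all∈ G-cc H-cc (κ , ab) (κ , cd) T-convex (edge-in-side uv)
    (uv⊆T (x∈p∪q⁺ (inj₁ (x∈⁅x⁆ u)))) (uv⊆T (x∈p∪q⁺ (inj₂ (x∈⁅x⁆ v)))) z
  where open IdentificationProperties I
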